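{- If $G$ is a path of triangles graph with $|V(G)|\le 9$, then $\Lambda(G)\le 2$.
   Context: A triangle is a set of three pairwise adjacent vertices; $\Lambda(G)$ is the minimum size of a set of vertices meeting every triangle of $G$. Sets $X,Y$ are complete (anticomplete) if every vertex of $X$ is adjacent (non-adjacent) to every vertex of $Y$; $X,Y$ are matched if $X\cap Y=\emptyset$, $|X|=|Y|$ and every vertex of $X$ has a unique neighbor in $Y$ and vice versa. $G$ is a path of triangles graph if for some integer $n\ge1$ there is a partition of $V(G)$ into stable sets $X_1,\dots,X_{2n+1}$ satisfying: P1: For $1\le i\le n$ there is a nonempty $\hat X_{2i}\subseteq X_{2i}$, and at least one of $\hat X_{2i},\hat X_{2i+2}$ has cardinality 1. P2: For $1\le i<j\le 2n+1$: (1) if $j-i\equiv2\pmod3$ and there are non-adjacent $u\in X_i$, $v\in X_j$, then either $i,j$ are odd and $j=i+2$, or $i,j$ are even and $u\notin\hat X_i$, $v\notin\hat X_j$; (2) if $j-i\not\equiv2\pmod 3$ then either $j=i+1$ or $X_i$ is anticomplete to $X_j$. P3: For $1\le i\le n+1$, $X_{2i-1}$ is the union of three pairwise disjoint sets $L_{2i-1},M_{2i-1},R_{2i-1}$. P4: For $1\le i\le n$, $X_{2i}$ is anticomplete to $L_{2i-1}\cup R_{2i+1}$; $X_{2i}\setminus\hat X_{2i}$ is anticomplete to $M_{2i-1}\cup M_{2i+1}$; every vertex of $X_{2i}\setminus\hat X_{2i}$ is adjacent to exactly one end of every edge between $R_{2i-1}$ and $L_{2i+1}$. P5: For $1\le i\le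 n$, if $|\hat X_{2i}|=1$ then (1) $R_{2i-1},L_{2i+1}$ are matched, and every edge between $M_{2i-1}\cup R_{2i-1}$ and $L_{2i+1}\cup M_{2i+1}$ is between $R_{2i-1}$ and $L_{2i+1}$; (2) the vertex of $\hat X_{2i}$ is complete to $R_{2i-1}\cup M_{2i-1}\cup L_{2i+1}\cup M_{2i+1}$; (3) $L_{2i-1}$ is complete to $X_{2i+1}$ and $X_{2i-1}$ is complete to $R_{2i+1}$; (4) if $i>1$, $M_{2i-1},\hat X_{2i-2}$ are matched, and if $i<n$, $M_{2i+1},\hat X_{2i+2}$ are matched. P6: For $1\le i\le n$, if $|\hat X_{2i}|>1$ then (1) $R_{2i-1}=L_{2i+1}=\emptyset$; (2) if $u\in X_{2i-1}$ and $v\in X_{2i+1}$, then $u,v$ are non-adjacent iff they have the same neighbor in $\hat X_{2i}$. P7: (1) $|\hat X_2|=|\hat X_{2n}|=1$; (2) $L_1=M_1=M_{2n+1}=R_{2n+1}=\emptyset$; (3) if $R_1=\emptyset$ then $n\ge2$ and $|\hat X_4|>1$, and if $L_{2n+1}=\emptyset$ then $n\ge2$ and $|\hat X_{2n-2}|>1$. -}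

module Defs where

open import Data.Nat using (ℕ; zero; suc; _+_; _*_; _∸_; _≤_; _<_; _≡ᵇ_)
open import Data.Nat.DivMod using (_%_)
open import Data.Bool using (Bool; true; false; T; _∧_; _∨_; not; _xor_; if_then_else_)
open import Data.Fin using (Fin)
open import Data.List using (List; map; allFin)
open import Data.Nat.ListAction using (sum)
open import Data.Product using (Σ; ∃; _×_; _,_)
open import Data.Sum using (_⊎_)
open import Relation.Nullary using (¬_)
open import Relation.Binary.PropositionalEquality using (_≡_; _≢_)

record Graph : Set where
  field
    N       : ℕ
    adj     : Fin N → Fin N → Bool
    adj-sym : ∀ u v → adj u v ≡ adj v u
    irrefl  : ∀ v → adj v v ≡ false

VSet : ℕ → Set
VSet N = Fin N → Bool

card : {N : ℕ} → VSet N → ℕ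
card {N} S = sum (map (λ v → if S v then 1 else 0) (allFin N))

module _ {N : ℕ} where
  infixr 6 _∪ₛ_
  infixl 7 _∖ₛ_
  infix 4 _∈ₛ_

  _∈ₛ_ : Fin N → VSet N → Set
  v ∈ₛ S = T (S v)

  _∪ₛ_ : VSet N → VSet N → VSet N
  (S ∪ₛ S′) v = S v ∨ S′ v

  _∖ₛ_ : VSet N → VSet N → VSet N
  (S ∖ₛ S′) v = S v ∧ not (S′ v)

  IsEmpty : VSet N → Set
  IsEmpty S = ∀ v → S v ≡ false

module GraphNotions (G : Graph) where
  open Graph G

  E : Fin N → Fin N → Set
  E u v = T (adj u v)

  Triangle : Fin N → Fin N → Fin N → Set
  Triangle a b c = E a b × E b c × E a c

  Complete : VSet N → VSet N → Set
  Complete S S′ = ∀ u v → u ∈ₛ S → v ∈ₛ S′ → E u v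

  Anticomplete : VSet N → VSet N → Set
  Anticomplete S S′ = ∀ u v → u ∈ₛ S → v ∈ₛ S′ → ¬ E u v

  UniqueNbr : Fin N → VSet N → Set
  UniqueNbr x S = Σ (Fin N) λ y → y ∈ₛ S × E x y × (∀ y′ → y′ ∈ₛ S → E x y′ → y′ ≡ y)

  Matched : VSet N → VSet N → Set
  Matched S S′ =
    (∀ v → v ∈ₛ S → ¬ v ∈ₛ S′) ×
    card S ≡ card S′ ×
    (∀ x → x ∈ₛ S → UniqueNbr x S′) ×
    (∀ y → y ∈ₛ S′ → UniqueNbr y S)

  MeetsAllTriangles : VSet N → Set
  MeetsAllTriangles S = ∀ a b c → Triangle a b c → a ∈ₛ S ⊎ b ∈ₛ S ⊎ c ∈ₛ S

-- Λ(G) ≤ k : some set of at most k vertices meets every triangle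
-- (equivalently, the minimum size of such a set is at most k).
Λ≤ : Graph → ℕ → Set
Λ≤ G k = Σ (VSet (Graph.N G)) λ S → card S ≤ k × GraphNotions.MeetsAllTriangles G S

data LMR : Set where
  L M R : LMR

_≡ₗ_ : LMR → LMR → Bool
L ≡ₗ L = true
M ≡ₗ M = true
R ≡ₗ R = true
_ ≡ₗ _ = false

-- Parameters:
--   idx v  : the index i (1 ≤ i ≤ 2n+1) of the part X_i containing v;
--   hat    : the union of all the sets X̂_{2i};
--   lmr v  : which of L, M, R contains v (only meaningful if idx v is odd).
module PoT (G : Graph) (n : ℕ) (idx : Fin (Graph.N G) → ℕ)
           (hat : VSet (Graph.N G)) (lmr : Fin (Graph.N G) → LMR) where
  open Graph G
  open GraphNotions G

  Odd : ℕ → Set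
  Odd i = i % 2 ≡ 1

  EvenN : ℕ → Set
  EvenN i = i % 2 ≡ 0

  X : ℕ → VSet N
  X i v = idx v ≡ᵇ i

  Xh : ℕ → VSet N
  Xh k v = hat v ∧ (idx v ≡ᵇ 2 * k)

  Lₛ Mₛ Rₛ : ℕ → VSet N
  Lₛ i v = (idx v ≡ᵇ i) ∧ (lmr v ≡ₗ L)
  Mₛ i v = (idx v ≡ᵇ i) ∧ (lmr v ≡ₗ M)
  Rₛ i v = (idx v ≡ᵇ i) ∧ (lmr v ≡ₗ R)

  record Conditions : Set where
    field
      n≥1       : 1 ≤ n
      idx-range : ∀ v → 1 ≤ idx v × idx v ≤ 2 * n + 1
      stable    : ∀ u v → idx u ≡ idx v → ¬ E u v
      hat-even  : ∀ v → v ∈ₛ hat → EvenN (idx v)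

      P1-nonempty : ∀ i → 1 ≤ i → i ≤ n → 1 ≤ card (Xh i)
      P1-one      : ∀ i → 1 ≤ i → i < n → card (Xh i) ≡ 1 ⊎ card (Xh (suc i)) ≡ 1

      P2-1 : ∀ u v → idx u < idx v → (idx v ∸ idx u) % 3 ≡ 2 → ¬ E u v →
               (Odd (idx u) × Odd (idx v) × idx v ≡ idx u + 2)
             ⊎ (EvenN (idx u) × EvenN (idx v) × ¬ u ∈ₛ hat × ¬ v ∈ₛ hat)
      P2-2 : ∀ u v → idx u < idx v → (idx v ∸ idx u) % 3 ≢ 2 →
               idx v ≡ suc (idx u) ⊎ ¬ E u v

      -- P3 is built into the representation (lmr).

      P4-1 : ∀ i → 1 ≤ i → i ≤ n →
               Anticomplete (X (2 * i)) (Lₛ (2 * i ∸ 1) ∪ₛ Rₛ (2 * i + 1))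
      P4-2 : ∀ i → 1 ≤ i → i ≤ n →
               Anticomplete (X (2 * i) ∖ₛ Xh i) (Mₛ (2 * i ∸ 1) ∪ₛ Mₛ (2 * i + 1))
      P4-3 : ∀ i → 1 ≤ i → i ≤ n → ∀ x a b →
               x ∈ₛ (X (2 * i) ∖ₛ Xh i) → a ∈ₛ Rₛ (2 * i ∸ 1) → b ∈ₛ Lₛ (2 * i + 1) → E a b →
               (E x a × ¬ E x b) ⊎ (¬ E x a × E x b)

      P5-1a : ∀ i → 1 ≤ i → i ≤ n → card (Xh i) ≡ 1 →
                Matched (Rₛ (2 * i ∸ 1)) (Lₛ (2 * i + 1))
      P5-1b : ∀ i → 1 ≤ i → i ≤ n → card (Xh i) ≡ 1 → ∀ a b →
                a ∈ₛ (Mₛ (2 * i ∸ 1) ∪ₛ Rₛ (2 * i ∸ 1)) →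
                b ∈ₛ (Lₛ (2 * i + 1) ∪ₛ Mₛ (2 * i + 1)) → E a b →
                a ∈ₛ Rₛ (2 * i ∸ 1) × b ∈ₛ Lₛ (2 * i + 1)
      P5-2  : ∀ i → 1 ≤ i → i ≤ n → card (Xh i) ≡ 1 →
                Complete (Xh i) (Rₛ (2 * i ∸ 1) ∪ₛ Mₛ (2 * i ∸ 1) ∪ₛ Lₛ (2 * i + 1) ∪ₛ Mₛ (2 * i + 1))
      P5-3a : ∀ i → 1 ≤ i → i ≤ n → card (Xh i) ≡ 1 →
                Complete (Lₛ (2 * i ∸ 1)) (X (2 * i + 1))
      P5-3b : ∀ i → 1 ≤ i → i ≤ n → card (Xh i) ≡ 1 →
                Complete (X (2 * i ∸ 1)) (Rₛ (2 * i + 1))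
      P5-4a : ∀ i → 1 < i → i ≤ n → card (Xh i) ≡ 1 →
                Matched (Mₛ (2 * i ∸ 1)) (Xh (i ∸ 1))
      P5-4b : ∀ i → 1 ≤ i → i < n → card (Xh i) ≡ 1 →
                Matched (Mₛ (2 * i + 1)) (Xh (suc i))

      P6-1  : ∀ i → 1 ≤ i → i ≤ n → 1 < card (Xh i) →
                IsEmpty (Rₛ (2 * i ∸ 1)) × IsEmpty (Lₛ (2 * i + 1))
      P6-2  : ∀ i → 1 ≤ i → i ≤ n → 1 < card (Xh i) → ∀ u v →
                u ∈ₛ X (2 * i ∸ 1) → v ∈ₛ X (2 * i + 1) →
                (¬ E u v → Σ (Fin N) λ w → w ∈ₛ Xh i × E u w × E v w) ×
                ((Σ (Fin N) λ w → w ∈ₛ Xh i × E u w × E v w) → ¬ E u v)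

      P7-1  : card (Xh 1) ≡ 1 × card (Xh n) ≡ 1
      P7-2  : IsEmpty (Lₛ 1) × IsEmpty (Mₛ 1) × IsEmpty (Mₛ (2 * n + 1)) × IsEmpty (Rₛ (2 * n + 1))
      P7-3a : IsEmpty (Rₛ 1) → 2 ≤ n × 1 < card (Xh 2)
      P7-3b : IsEmpty (Lₛ (2 * n + 1)) → 2 ≤ n × 1 < card (Xh (n ∸ 1))

IsPathOfTriangles : Graph → Set
IsPathOfTriangles G =
  Σ ℕ λ n → Σ (Fin (Graph.N G) → ℕ) λ idx → Σ (VSet (Graph.N G)) λ hat →
  Σ (Fin (Graph.N G) → LMR) λ lmr → PoT.Conditions G n idx hat lmr

{-# OPTIONS --safe #-}

-- By P2, the three vertices of a triangle lie in consecutive parts. If they are X_{2i-1}, X_{2i},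
-- X_{2i+1}, then P4 and P6 force the middle vertex to be the unique vertex of X̂_{2i} (an apex),
-- with its neighbours in R_{2i-1} and L_{2i+1}; if they are X_{2i}, X_{2i+1}, X_{2i+2}, the two
-- outer vertices lie in X̂_{2i} and X̂_{2i+2}. Hence X̂_2 ∪ X̂_{2n}, which has at most two vertices by P7,
-- meets every triangle unless n ≥ 4 or some apex has 1 < i < n. In either case ten vertices are
-- found in pairwise disjoint sets: the X̂_{2k} and M_{2k+1} (nonempty by P1 and P5), the R and L
-- sets next to the apex, and at each end of the path either R_1 and L_3 (resp. R_{2n-1} and
-- L_{2n+1}) or a second vertex of X̂_4 (resp. X̂_{2n-2}), by P5 and P7.

module Submission where

open import Defs
open import Data.Bool using (Bool; true; false; T; _∧_; _∨_; not; if_then_else_)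
open import Data.Bool.Properties using (T-∧; T-∨)
open import Data.Empty using (⊥; ⊥-elim)
open import Data.Fin using (Fin)
open import Data.List using (List; []; _∷_; map; foldr; allFin; length)
open import Data.List.Properties using (length-tabulate)
open import Data.List.Membership.Propositional using (_∈_)
open import Data.List.Membership.Propositional.Properties using (∈-allFin)
open import Data.List.Relation.Unary.All using (All; []; _∷_)
open import Data.List.Relation.Unary.AllPairs as AllPairs using (AllPairs; []; _∷_; allPairs?)
open import Data.List.Relation.Unary.AllPairs.Properties using (map⁺)
open import Data.List.Relation.Unary.Any using (here; there)
open import Data.List.Relation.Binary.Pointwise using (Pointwise; []; _∷_)
open import Data.Nat using (ℕ; zero; suc; _+_; _*_; _∸_; _≤_; _<_; _≡ᵇ_; z≤n; s≤s; s≤s⁻¹; z<s)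
open import Data.Nat.DivMod using (_%_; %-distribˡ-+)
open import Data.Nat.ListAction using (sum)
open import Data.Nat.Properties
open import Algebra.Properties.CommutativeSemigroup +-commutativeSemigroup using (interchange)
open import Data.Product using (∃; _×_; _,_; proj₁; proj₂)
open import Data.Sum using (_⊎_; inj₁; inj₂)
open import Function using (_∘_; Equivalence)
open import Relation.Nullary using (¬_; yes; no; contradiction)
open import Relation.Nullary.Decidable using (True; toWitness; T?)
open import Relation.Binary.Definitions using (tri<; tri≈; tri>)
open import Relation.Binary.PropositionalEquality using (_≡_; refl; sym; trans; cong; cong₂; subst)

open Equivalence using (to; from)

indicator : Bool → ℕ
indicator b = if b then 1 else 0

module _ {A : Set} where

  sum-map-+ : (f g : A → ℕ) (xs : List A) →
              sum (map (λ x → f x + g x) xs) ≡ sum (map f xs) + sum (map g xs)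
  sum-map-+ f g [] = refl
  sum-map-+ f g (x ∷ xs) = trans (cong (f x + g x +_) (sum-map-+ f g xs))
                                 (interchange (f x) (g x) (sum (map f xs)) (sum (map g xs)))

  sum-map-mono : {f g : A → ℕ} → (∀ x → f x ≤ g x) → (xs : List A) → sum (map f xs) ≤ sum (map g xs)
  sum-map-mono f≤g [] = z≤n
  sum-map-mono f≤g (x ∷ xs) = +-mono-≤ (f≤g x) (sum-map-mono f≤g xs)

  sum-map-1 : (xs : List A) → sum (map (λ _ → 1) xs) ≡ length xs
  sum-map-1 [] = refl
  sum-map-1 (x ∷ xs) = cong suc (sum-map-1 xs)

  ∈⇒≤-sum-map : (f : A → ℕ) {x : A} {xs : List A} → x ∈ xs → f x ≤ sum (map f xs)
  ∈⇒≤-sum-map f (here refl) = m≤m+n _ _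
  ∈⇒≤-sum-map f {xs = y ∷ _} (there x∈xs) = ≤-trans (∈⇒≤-sum-map f x∈xs) (m≤n+m _ (f y))

module _ {N : ℕ} where

  Disjoint : VSet N → VSet N → Set
  Disjoint S S′ = ∀ v → v ∈ₛ S → v ∈ₛ S′ → ⊥

  ⋃ₛ : List (VSet N) → VSet N
  ⋃ₛ = foldr _∪ₛ_ (λ _ → false)

  card-∪ : (S S′ : VSet N) → card (S ∪ₛ S′) ≤ card S + card S′
  card-∪ S S′ = ≤-trans (sum-map-mono (λ v → indicator-∨≤ (S v) (S′ v)) (allFin N))
                        (≤-reflexive (sum-map-+ (indicator ∘ S) (indicator ∘ S′) (allFin N)))
    where
    indicator-∨≤ : ∀ a b → indicator (a ∨ b) ≤ indicator a + indicator b
    indicator-∨≤ true  _ = s≤s z≤n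
    indicator-∨≤ false _ = ≤-refl

  card-∪-disjoint : (S S′ : VSet N) → Disjoint S S′ → card S + card S′ ≤ card (S ∪ₛ S′)
  card-∪-disjoint S S′ S#S′ =
    ≤-trans (≤-reflexive (sym (sum-map-+ (indicator ∘ S) (indicator ∘ S′) (allFin N))))
            (sum-map-mono (λ v → indicator-∨≥ (S v) (S′ v) (S#S′ v)) (allFin N))
    where
    indicator-∨≥ : ∀ a b → (T a → T b → ⊥) → indicator a + indicator b ≤ indicator (a ∨ b)
    indicator-∨≥ true  true  a#b = ⊥-elim (a#b _ _)
    indicator-∨≥ true  false _   = ≤-refl
    indicator-∨≥ false _     _   = ≤-refl

  card≤N : (S : VSet N) → card S ≤ N
  card≤N S = ≤-trans (sum-map-mono (λ v → indicator≤1 (S v)) (allFin N))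
                     (≤-reflexive (trans (sum-map-1 (allFin N)) (length-tabulate (λ v → v))))
    where
    indicator≤1 : ∀ b → indicator b ≤ 1
    indicator≤1 true  = ≤-refl
    indicator≤1 false = z≤n

  disjoint-⋃ : ∀ {S} Ss → All (Disjoint S) Ss → Disjoint S (⋃ₛ Ss)
  disjoint-⋃ (S′ ∷ Ss) (S#S′ ∷ S#Ss) v v∈S v∈⋃ with to T-∨ v∈⋃
  ... | inj₁ v∈S′ = S#S′ v v∈S v∈S′
  ... | inj₂ v∈⋃Ss = disjoint-⋃ Ss S#Ss v v∈S v∈⋃Ss

  sum-card≤card-⋃ : (Ss : List (VSet N)) → AllPairs Disjoint Ss → sum (map card Ss) ≤ card (⋃ₛ Ss)
  sum-card≤card-⋃ [] [] = z≤n
  sum-card≤card-⋃ (S ∷ Ss) (S#Ss ∷ Ss-disjoint) =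
    ≤-trans (+-monoʳ-≤ (card S) (sum-card≤card-⋃ Ss Ss-disjoint))
            (card-∪-disjoint S (⋃ₛ Ss) (disjoint-⋃ Ss S#Ss))

  indicator≤card : (S : VSet N) (v : Fin N) → indicator (S v) ≤ card S
  indicator≤card S v = ∈⇒≤-sum-map (indicator ∘ S) (∈-allFin v)

  ∈⇒1≤card : (S : VSet N) {v : Fin N} → v ∈ₛ S → 1 ≤ card S
  ∈⇒1≤card S {v} v∈S = ≤-trans (1≤indicator (S v) v∈S) (indicator≤card S v)
    where
    1≤indicator : ∀ b → T b → 1 ≤ indicator b
    1≤indicator true _ = ≤-refl

  IsEmpty⊎1≤card : (S : VSet N) → IsEmpty S ⊎ 1 ≤ card S
  IsEmpty⊎1≤card S with card S in card≡
  ... | suc _ = inj₂ (s≤s z≤n)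
  ... | zero  = inj₁ λ v → indicator≡0 (S v) (n≤0⇒n≡0 (subst (indicator (S v) ≤_) card≡ (indicator≤card S v)))
    where
    indicator≡0 : ∀ b → indicator b ≡ 0 → b ≡ false
    indicator≡0 false _ = refl

AdmissibleGap : ℕ → Set
AdmissibleGap d = d ≡ 1 ⊎ d % 3 ≡ 2

+-%3 : ∀ d₁ d₂ {r₁ r₂} → d₁ % 3 ≡ r₁ → d₂ % 3 ≡ r₂ → (d₁ + d₂) % 3 ≡ (r₁ + r₂) % 3
+-%3 d₁ d₂ refl refl = %-distribˡ-+ d₁ d₂ 3

-- Residues 1 and 2 add up to 2 mod 3 only as 1 + 1, and an admissible gap with residue 1 is 1.
admissible-gaps-of-sum : ∀ {d₁ d₂} → AdmissibleGap d₁ → AdmissibleGap d₂ → (d₁ + d₂) % 3 ≡ 2 →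
                         d₁ ≡ 1 × d₂ ≡ 1
admissible-gaps-of-sum (inj₁ refl) (inj₁ refl) _ = refl , refl
admissible-gaps-of-sum {d₂ = d₂} (inj₁ refl) (inj₂ r₂) s with () ← trans (sym (+-%3 1 d₂ refl r₂)) s
admissible-gaps-of-sum {d₁} (inj₂ r₁) (inj₁ refl) s with () ← trans (sym (+-%3 d₁ 1 r₁ refl)) s
admissible-gaps-of-sum {d₁} {d₂} (inj₂ r₁) (inj₂ r₂) s with () ← trans (sym (+-%3 d₁ d₂ r₁ r₂)) s

consecutive-if-admissible : ∀ {i j k} → i < j → j < k →
  AdmissibleGap (j ∸ i) → AdmissibleGap (k ∸ j) → AdmissibleGap (k ∸ i) → j ≡ suc i × k ≡ suc j
consecutive-if-admissible {i} {j} {k} i<j j<k gᵢⱼ gⱼₖ gᵢₖ =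
  let j∸i≡1 , k∸j≡1 = admissible-gaps-of-sum gᵢⱼ gⱼₖ sum%3≡2
  in  unit-gap (<⇒≤ i<j) j∸i≡1 , unit-gap (<⇒≤ j<k) k∸j≡1
  where
  k∸i≡ : k ∸ i ≡ (j ∸ i) + (k ∸ j)
  k∸i≡ = trans (cong (_∸ i) (sym (m+[n∸m]≡n (<⇒≤ j<k)))) (+-∸-comm (k ∸ j) (<⇒≤ i<j))
  sum%3≡2 : ((j ∸ i) + (k ∸ j)) % 3 ≡ 2
  sum%3≡2 with subst AdmissibleGap k∸i≡ gᵢₖ
  ... | inj₂ r     = r
  ... | inj₁ sum≡1 = contradiction sum≡1 (>⇒≢ (+-mono-≤ (m<n⇒0<n∸m i<j) (m<n⇒0<n∸m j<k)))
  unit-gap : ∀ {m n} → m ≤ n → n ∸ m ≡ 1 → n ≡ suc m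
  unit-gap {m} m≤n n∸m≡1 = trans (sym (m+[n∸m]≡n m≤n)) (trans (cong (m +_) n∸m≡1) (+-comm m 1))

even⊎odd : ∀ m → (∃ λ k → m ≡ 2 * k) ⊎ (∃ λ k → m ≡ suc (2 * k))
even⊎odd zero = inj₁ (0 , refl)
even⊎odd (suc m) with even⊎odd m
... | inj₁ (k , refl) = inj₂ (k , refl)
... | inj₂ (k , refl) = inj₁ (suc k , sym (*-suc 2 k))

2*m≤2*n+1⇒m≤n : ∀ {m n} → 2 * m ≤ 2 * n + 1 → m ≤ n
2*m≤2*n+1⇒m≤n {m} {n} le = s≤s⁻¹ (*-cancelˡ-< 2 m (suc n) (≤-trans (s≤s le) (≤-reflexive 2n+2≡)))
  where
  2n+2≡ : suc (2 * n + 1) ≡ 2 * suc n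
  2n+2≡ = trans (cong suc (+-comm (2 * n) 1)) (sym (*-suc 2 n))

1≤2*m⇒1≤m : ∀ {m} → 1 ≤ 2 * m → 1 ≤ m
1≤2*m⇒1≤m {suc m} _ = s≤s z≤n

2*[1+m]∸1≡2*m+1 : ∀ m → 2 * suc m ∸ 1 ≡ 2 * m + 1
2*[1+m]∸1≡2*m+1 m = trans (cong (_∸ 1) (*-suc 2 m)) (+-comm 1 (2 * m))

module _ (G : Graph) where
  open Graph G
  open GraphNotions G

  E-sym : ∀ {u v} → E u v → E v u
  E-sym {u} {v} = subst T (adj-sym u v)

  triangle-swap₁₂ : ∀ {a b c} → Triangle a b c → Triangle b a c
  triangle-swap₁₂ (ab , bc , ac) = E-sym ab , ac , bc

  triangle-swap₂₃ : ∀ {a b c} → Triangle a b c → Triangle a c b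
  triangle-swap₂₃ (ab , bc , ac) = ac , E-sym bc , ab

  module _ (S : VSet N) where

    Meets : Fin N → Fin N → Fin N → Set
    Meets a b c = a ∈ₛ S ⊎ b ∈ₛ S ⊎ c ∈ₛ S

    meets-swap₁₂ : ∀ {a b c} → Meets a b c → Meets b a c
    meets-swap₁₂ (inj₁ a∈S)        = inj₂ (inj₁ a∈S)
    meets-swap₁₂ (inj₂ (inj₁ b∈S)) = inj₁ b∈S
    meets-swap₁₂ (inj₂ (inj₂ c∈S)) = inj₂ (inj₂ c∈S)

    meets-swap₂₃ : ∀ {a b c} → Meets a b c → Meets a c b
    meets-swap₂₃ (inj₁ a∈S)        = inj₁ a∈S
    meets-swap₂₃ (inj₂ (inj₁ b∈S)) = inj₂ (inj₂ b∈S)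
    meets-swap₂₃ (inj₂ (inj₂ c∈S)) = inj₂ (inj₁ c∈S)

    module _ (rank : Fin N → ℕ) (stable : ∀ u v → rank u ≡ rank v → ¬ E u v)
             (meets-sorted : ∀ a b c → rank a < rank b → rank b < rank c → Triangle a b c → Meets a b c)
             where

      meets-if-first-two-sorted : ∀ a b c → rank a < rank b → Triangle a b c → Meets a b c
      meets-if-first-two-sorted a b c a<b t@(ab , bc , ac) with <-cmp (rank b) (rank c) | <-cmp (rank a) (rank c)
      ... | tri< b<c _ _ | _            = meets-sorted a b c a<b b<c t
      ... | tri≈ _ b≡c _ | _            = ⊥-elim (stable b c b≡c bc)
      ... | tri> _ _ c<b | tri< a<c _ _ = meets-swap₂₃ (meets-sorted a c b a<c c<b (triangle-swap₂₃ t))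
      ... | tri> _ _ _   | tri≈ _ a≡c _ = ⊥-elim (stable a c a≡c ac)
      ... | tri> _ _ _   | tri> _ _ c<a =
        meets-swap₂₃ (meets-swap₁₂ (meets-sorted c a b c<a a<b (triangle-swap₁₂ (triangle-swap₂₃ t))))

      meets-all-triangles-if-sorted : MeetsAllTriangles S
      meets-all-triangles-if-sorted a b c t with <-cmp (rank a) (rank b)
      ... | tri< a<b _ _ = meets-if-first-two-sorted a b c a<b t
      ... | tri≈ _ a≡b _ = ⊥-elim (stable a b a≡b (proj₁ t))
      ... | tri> _ _ b<a = meets-swap₁₂ (meets-if-first-two-sorted b a c b<a (triangle-swap₁₂ t))

≡ₗ⇒≡ : ∀ l l′ → T (l ≡ₗ l′) → l ≡ l′
≡ₗ⇒≡ L L _ = refl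
≡ₗ⇒≡ M M _ = refl
≡ₗ⇒≡ R R _ = refl
≡ₗ⇒≡ L M ()
≡ₗ⇒≡ L R ()
≡ₗ⇒≡ M L ()
≡ₗ⇒≡ M R ()
≡ₗ⇒≡ R L ()
≡ₗ⇒≡ R M ()

≡ₗ-refl : ∀ l → T (l ≡ₗ l)
≡ₗ-refl L = _
≡ₗ-refl M = _
≡ₗ-refl R = _

T-not⇒¬T : ∀ b → T (not b) → ¬ T b
T-not⇒¬T true  ()
T-not⇒¬T false _ ()

-- A cell names one of the sets X̂_{2k} or L_j, M_j, R_j. Cells that are apart are disjoint,
-- so the disjointness of a concrete list of cells is checked by evaluation in sum-bounds≤N.
data Cell : Set where
  X̂-cell    : ℕ → Cell
  part-cell : ℕ → LMR → Cell

cell-index : Cell → ℕ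
cell-index (X̂-cell k)      = 2 * k
cell-index (part-cell j _) = j

different-parts : Cell → Cell → Bool
different-parts (part-cell _ l) (part-cell _ l′) = not (l ≡ₗ l′)
different-parts _               _                = false

apart : Cell → Cell → Bool
apart c c′ = not (cell-index c ≡ᵇ cell-index c′) ∨ different-parts c c′

module PathOfTriangles (G : Graph) (n : ℕ) (idx : Fin (Graph.N G) → ℕ) (hat : VSet (Graph.N G))
                       (lmr : Fin (Graph.N G) → LMR) (C : PoT.Conditions G n idx hat lmr) where
  open Graph G
  open GraphNotions G
  open PoT G n idx hat lmr
  open PoT.Conditions C

  ∈X : ∀ {v j} → idx v ≡ j → v ∈ₛ X j
  ∈X {v} {j} = ≡⇒≡ᵇ (idx v) j

  X-parts : ∀ {v j} → v ∈ₛ X j → v ∈ₛ Lₛ j ⊎ v ∈ₛ Mₛ j ⊎ v ∈ₛ Rₛ j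
  X-parts {v} v∈X with lmr v
  ... | L = inj₁ (from T-∧ (v∈X , _))
  ... | M = inj₂ (inj₁ (from T-∧ (v∈X , _)))
  ... | R = inj₂ (inj₂ (from T-∧ (v∈X , _)))

  X-hat-or-not : ∀ {v} k → v ∈ₛ X (2 * k) → v ∈ₛ Xh k ⊎ v ∈ₛ (X (2 * k) ∖ₛ Xh k)
  X-hat-or-not {v} k v∈X with hat v
  ... | true  = inj₁ v∈X
  ... | false = inj₂ (from T-∧ (v∈X , _))

  matched⇒card≡ : ∀ {S S′} → Matched S S′ → card S ≡ card S′
  matched⇒card≡ = proj₁ ∘ proj₂

  apex-triangle : ∀ {i a b c} → 1 ≤ i → i ≤ n →
    a ∈ₛ X (2 * i ∸ 1) → b ∈ₛ X (2 * i) → c ∈ₛ X (2 * i + 1) → Triangle a b c →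
    b ∈ₛ Xh i × card (Xh i) ≡ 1 × a ∈ₛ Rₛ (2 * i ∸ 1) × c ∈ₛ Lₛ (2 * i + 1)
  apex-triangle {i} {a} {b} {c} 1≤i i≤n a∈X b∈X c∈X (ab , bc , ac) =
    b∈X̂ , X̂-single , P5-1b i 1≤i i≤n X̂-single a c a∈M∪R c∈L∪M ac
    where
    a∈M∪R : a ∈ₛ (Mₛ (2 * i ∸ 1) ∪ₛ Rₛ (2 * i ∸ 1))
    a∈M∪R with X-parts a∈X
    ... | inj₁ a∈L    = ⊥-elim (P4-1 i 1≤i i≤n b a b∈X (from T-∨ (inj₁ a∈L)) (E-sym G ab))
    ... | inj₂ a∈M⊎R = from T-∨ a∈M⊎R
    c∈L∪M : c ∈ₛ (Lₛ (2 * i + 1) ∪ₛ Mₛ (2 * i + 1))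
    c∈L∪M with X-parts c∈X
    ... | inj₁ c∈L        = from T-∨ (inj₁ c∈L)
    ... | inj₂ (inj₁ c∈M) = from T-∨ (inj₂ c∈M)
    ... | inj₂ (inj₂ c∈R) = ⊥-elim (P4-1 i 1≤i i≤n b c b∈X (from T-∨ (inj₂ c∈R)) bc)
    b∉X∖X̂ : ¬ b ∈ₛ (X (2 * i) ∖ₛ Xh i)
    b∉X∖X̂ b∈X∖X̂ with to T-∨ a∈M∪R | to T-∨ c∈L∪M
    ... | inj₁ a∈M | _        = P4-2 i 1≤i i≤n b a b∈X∖X̂ (from T-∨ (inj₁ a∈M)) (E-sym G ab)
    ... | _        | inj₂ c∈M = P4-2 i 1≤i i≤n b c b∈X∖X̂ (from T-∨ (inj₂ c∈M)) bc
    ... | inj₂ a∈R | inj₁ c∈L with P4-3 i 1≤i i≤n b a c b∈X∖X̂ a∈R c∈L ac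
    ...   | inj₁ (_ , ¬bc) = ¬bc bc
    ...   | inj₂ (¬ba , _) = ¬ba (E-sym G ab)
    b∈X̂ : b ∈ₛ Xh i
    b∈X̂ with X-hat-or-not i b∈X
    ... | inj₁ b∈X̂   = b∈X̂
    ... | inj₂ b∈X∖X̂ = ⊥-elim (b∉X∖X̂ b∈X∖X̂)
    X̂-single : card (Xh i) ≡ 1
    X̂-single with m≤n⇒m<n∨m≡n (P1-nonempty i 1≤i i≤n)
    ... | inj₂ 1≡card = sym 1≡card
    ... | inj₁ 1<card = ⊥-elim (proj₂ (P6-2 i 1≤i i≤n 1<card a c a∈X c∈X) (b , b∈X̂ , ab , E-sym G bc) ac)

  hat-pair-triangle : ∀ {i a b c} → 1 ≤ i → suc i ≤ n →
    a ∈ₛ X (2 * i) → b ∈ₛ X (2 * i + 1) → c ∈ₛ X (2 * suc i) → Triangle a b c →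
    a ∈ₛ Xh i × c ∈ₛ Xh (suc i)
  hat-pair-triangle {i} {a} {b} {c} 1≤i 1+i≤n a∈X b∈X c∈X (ab , bc , _) = a∈X̂ , c∈X̂
    where
    i≤n : i ≤ n
    i≤n = <⇒≤ 1+i≤n
    as-left-of-suc-i : ∀ {S : ℕ → VSet N} → b ∈ₛ S (2 * i + 1) → b ∈ₛ S (2 * suc i ∸ 1)
    as-left-of-suc-i {S} = subst (λ j → b ∈ₛ S j) (sym (2*[1+m]∸1≡2*m+1 i))
    b∈M : b ∈ₛ Mₛ (2 * i + 1)
    b∈M with X-parts b∈X
    ... | inj₁ b∈L =
      ⊥-elim (P4-1 (suc i) z<s 1+i≤n c b c∈X (from T-∨ (inj₁ (as-left-of-suc-i {Lₛ} b∈L))) (E-sym G bc))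
    ... | inj₂ (inj₁ b∈M) = b∈M
    ... | inj₂ (inj₂ b∈R) = ⊥-elim (P4-1 i 1≤i i≤n a b a∈X (from T-∨ (inj₂ b∈R)) ab)
    a∈X̂ : a ∈ₛ Xh i
    a∈X̂ with X-hat-or-not i a∈X
    ... | inj₁ a∈X̂   = a∈X̂
    ... | inj₂ a∈X∖X̂ = ⊥-elim (P4-2 i 1≤i i≤n a b a∈X∖X̂ (from T-∨ (inj₂ b∈M)) ab)
    c∈X̂ : c ∈ₛ Xh (suc i)
    c∈X̂ with X-hat-or-not (suc i) c∈X
    ... | inj₁ c∈X̂   = c∈X̂
    ... | inj₂ c∈X∖X̂ =
      ⊥-elim (P4-2 (suc i) z<s 1+i≤n c b c∈X∖X̂ (from T-∨ (inj₁ (as-left-of-suc-i {Mₛ} b∈M))) (E-sym G bc))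

  adjacent-gap : ∀ {u v} → E u v → idx u < idx v → AdmissibleGap (idx v ∸ idx u)
  adjacent-gap {u} {v} uv u<v with (idx v ∸ idx u) % 3 ≟ 2
  ... | yes gap%3≡2 = inj₂ gap%3≡2
  ... | no  gap%3≢2 with P2-2 u v u<v gap%3≢2
  ...   | inj₁ v≡1+u = inj₁ (trans (cong (_∸ idx u) v≡1+u) (m+n∸n≡m 1 (idx u)))
  ...   | inj₂ ¬uv   = contradiction uv ¬uv

  data TriangleForm (a b c : Fin N) : Set where
    apex     : ∀ i → 1 ≤ i → i ≤ n → b ∈ₛ Xh i → card (Xh i) ≡ 1 →
               a ∈ₛ Rₛ (2 * i ∸ 1) → c ∈ₛ Lₛ (2 * i + 1) → TriangleForm a b c
    hat-pair : ∀ i → 1 ≤ i → suc i ≤ n → a ∈ₛ Xh i → c ∈ₛ Xh (suc i) → TriangleForm a b c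

  triangle-form : ∀ {a b c} → idx a < idx b → idx b < idx c → Triangle a b c → TriangleForm a b c
  triangle-form {a} {b} {c} a<b b<c t@(ab , bc , ac)
    with consecutive-if-admissible a<b b<c
           (adjacent-gap ab a<b) (adjacent-gap bc b<c) (adjacent-gap ac (<-trans a<b b<c))
       | even⊎odd (idx b)
  ... | b≡1+a , c≡1+b | inj₁ (i , b≡2i) =
    let b∈X̂ , X̂-single , a∈R , c∈L = apex-triangle 1≤i i≤n (∈X a≡2i∸1) (∈X b≡2i) (∈X c≡2i+1) t
    in  apex i 1≤i i≤n b∈X̂ X̂-single a∈R c∈L
    where
    a≡2i∸1 : idx a ≡ 2 * i ∸ 1
    a≡2i∸1 = cong (_∸ 1) (trans (sym b≡1+a) b≡2i)
    c≡2i+1 : idx c ≡ 2 * i + 1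
    c≡2i+1 = trans c≡1+b (trans (cong suc b≡2i) (+-comm 1 (2 * i)))
    1≤i : 1 ≤ i
    1≤i = 1≤2*m⇒1≤m (subst (1 ≤_) b≡2i (proj₁ (idx-range b)))
    i≤n : i ≤ n
    i≤n = 2*m≤2*n+1⇒m≤n (≤-trans (m≤m+n (2 * i) 1) (subst (_≤ 2 * n + 1) c≡2i+1 (proj₂ (idx-range c))))
  ... | b≡1+a , c≡1+b | inj₂ (i , b≡1+2i) =
    let a∈X̂ , c∈X̂ = hat-pair-triangle 1≤i 1+i≤n (∈X a≡2i) (∈X b≡2i+1) (∈X c≡2[1+i]) t
    in  hat-pair i 1≤i 1+i≤n a∈X̂ c∈X̂
    where
    a≡2i : idx a ≡ 2 * i
    a≡2i = suc-injective (trans (sym b≡1+a) b≡1+2i)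
    b≡2i+1 : idx b ≡ 2 * i + 1
    b≡2i+1 = trans b≡1+2i (+-comm 1 (2 * i))
    c≡2[1+i] : idx c ≡ 2 * suc i
    c≡2[1+i] = trans c≡1+b (trans (cong suc b≡1+2i) (sym (*-suc 2 i)))
    1≤i : 1 ≤ i
    1≤i = 1≤2*m⇒1≤m (subst (1 ≤_) a≡2i (proj₁ (idx-range a)))
    1+i≤n : suc i ≤ n
    1+i≤n = 2*m≤2*n+1⇒m≤n (subst (_≤ 2 * n + 1) c≡2[1+i] (proj₂ (idx-range c)))

  ⟦_⟧ : Cell → VSet N
  ⟦ X̂-cell k ⟧      = Xh k
  ⟦ part-cell j l ⟧ v = (idx v ≡ᵇ j) ∧ (lmr v ≡ₗ l)

  ∈⟦⟧⇒index : ∀ c {v} → v ∈ₛ ⟦ c ⟧ → idx v ≡ cell-index c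
  ∈⟦⟧⇒index (X̂-cell k)      {v} v∈c = ≡ᵇ⇒≡ (idx v) (2 * k) (proj₂ (to T-∧ v∈c))
  ∈⟦⟧⇒index (part-cell j _) {v} v∈c = ≡ᵇ⇒≡ (idx v) j (proj₁ (to T-∧ v∈c))

  different-parts⇒disjoint : ∀ c c′ → T (different-parts c c′) → Disjoint ⟦ c ⟧ ⟦ c′ ⟧
  different-parts⇒disjoint (part-cell _ l) (part-cell _ l′) l≢l′ v v∈c v∈c′ =
    T-not⇒¬T (l ≡ₗ l′) l≢l′ (subst (λ l″ → T (l ≡ₗ l″)) l≡l′ (≡ₗ-refl l))
    where
    l≡l′ : l ≡ l′
    l≡l′ = trans (sym (≡ₗ⇒≡ (lmr v) l (proj₂ (to T-∧ v∈c)))) (≡ₗ⇒≡ (lmr v) l′ (proj₂ (to T-∧ v∈c′)))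

  apart⇒disjoint : ∀ c c′ → T (apart c c′) → Disjoint ⟦ c ⟧ ⟦ c′ ⟧
  apart⇒disjoint c c′ c#c′ v v∈c v∈c′ with to T-∨ c#c′
  ... | inj₁ indices≢ = T-not⇒¬T (cell-index c ≡ᵇ cell-index c′) indices≢
          (≡⇒≡ᵇ _ _ (trans (sym (∈⟦⟧⇒index c v∈c)) (∈⟦⟧⇒index c′ v∈c′)))
  ... | inj₂ parts≢   = different-parts⇒disjoint c c′ parts≢ v v∈c v∈c′

  CellBounds : List ℕ → List Cell → Set
  CellBounds = Pointwise (λ b c → b ≤ card ⟦ c ⟧)

  sum-bounds≤sum-card : ∀ {bs cs} → CellBounds bs cs → sum bs ≤ sum (map card (map ⟦_⟧ cs))
  sum-bounds≤sum-card []         = z≤n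
  sum-bounds≤sum-card (b≤ ∷ bs≤) = +-mono-≤ b≤ (sum-bounds≤sum-card bs≤)

  sum-bounds≤N : (cs : List Cell) → {True (allPairs? (λ c c′ → T? (apart c c′)) cs)} →
                 ∀ {bs} → CellBounds bs cs → sum bs ≤ N
  sum-bounds≤N cs {cs-apart} bs≤ =
    ≤-trans (sum-bounds≤sum-card bs≤)
            (≤-trans (sum-card≤card-⋃ (map ⟦_⟧ cs)
                       (map⁺ (AllPairs.map (λ {c} {c′} → apart⇒disjoint c c′) (toWitness cs-apart))))
                     (card≤N _))

  X̂-nonempty : ∀ i {1≤i : True (1 ≤? i)} {i≤n : True (i ≤? n)} → 1 ≤ card (Xh i)
  X̂-nonempty i {1≤i} {i≤n} = P1-nonempty i (toWitness 1≤i) (toWitness i≤n)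

  M-nonempty : ∀ k {1≤k : True (1 ≤? k)} {k<n : True (k <? n)} → 1 ≤ card (Mₛ (2 * k + 1))
  M-nonempty k {1≤k} {k<n} with P1-one k (toWitness 1≤k) (toWitness k<n)
  ... | inj₁ X̂ₖ-single =
    subst (1 ≤_) (sym (matched⇒card≡ (P5-4b k (toWitness 1≤k) (toWitness k<n) X̂ₖ-single)))
          (P1-nonempty (suc k) z<s (toWitness k<n))
  ... | inj₂ X̂ₖ₊₁-single =
    subst (λ j → 1 ≤ card (Mₛ j)) (2*[1+m]∸1≡2*m+1 k)
      (subst (1 ≤_) (sym (matched⇒card≡ (P5-4a (suc k) (s≤s (toWitness 1≤k)) (toWitness k<n) X̂ₖ₊₁-single)))
             (P1-nonempty k (toWitness 1≤k) (<⇒≤ (toWitness k<n))))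

  left-end : 2 ≤ card (Xh 2) ⊎ (1 ≤ card (Rₛ 1) × 1 ≤ card (Lₛ 3))
  left-end with IsEmpty⊎1≤card (Rₛ 1)
  ... | inj₁ R₁-empty    = inj₁ (proj₂ (P7-3a R₁-empty))
  ... | inj₂ R₁-nonempty =
    inj₂ (R₁-nonempty , subst (1 ≤_) (matched⇒card≡ (P5-1a 1 ≤-refl n≥1 (proj₁ P7-1))) R₁-nonempty)

  right-end : 2 ≤ card (Xh (n ∸ 1)) ⊎ (1 ≤ card (Rₛ (2 * n ∸ 1)) × 1 ≤ card (Lₛ (2 * n + 1)))
  right-end with IsEmpty⊎1≤card (Lₛ (2 * n + 1))
  ... | inj₁ L-empty    = inj₁ (proj₂ (P7-3b L-empty))
  ... | inj₂ L-nonempty =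
    inj₂ (subst (1 ≤_) (sym (matched⇒card≡ (P5-1a n n≥1 ≤-refl (proj₂ P7-1)))) L-nonempty , L-nonempty)

  NoInnerApex : Set
  NoInnerApex = ∀ i → 1 < i → i < n → card (Xh i) ≡ 1 →
                1 ≤ card (Rₛ (2 * i ∸ 1)) → 1 ≤ card (Lₛ (2 * i + 1)) → ⊥

  ends : VSet N
  ends = Xh 1 ∪ₛ Xh n

  card-ends≤2 : card ends ≤ 2
  card-ends≤2 = ≤-trans (card-∪ (Xh 1) (Xh n)) (≤-reflexive (cong₂ _+_ (proj₁ P7-1) (proj₂ P7-1)))

  ∈X̂⇒∈ends : ∀ {v} i → 1 ≤ i → i ≤ n → v ∈ₛ Xh i → (1 < i → i < n → ⊥) → v ∈ₛ ends
  ∈X̂⇒∈ends i 1≤i i≤n v∈X̂ not-inner with i ≟ 1 | i ≟ n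
  ... | yes refl | _        = from T-∨ (inj₁ v∈X̂)
  ... | no  _    | yes refl = from T-∨ (inj₂ v∈X̂)
  ... | no  i≢1  | no  i≢n  = ⊥-elim (not-inner (≤∧≢⇒< 1≤i (i≢1 ∘ sym)) (≤∧≢⇒< i≤n i≢n))

  sorted-triangle-meets-ends : n ≤ 3 → NoInnerApex →
    ∀ a b c → idx a < idx b → idx b < idx c → Triangle a b c → Meets G ends a b c
  sorted-triangle-meets-ends n≤3 no-inner-apex a b c a<b b<c t with triangle-form a<b b<c t
  ... | apex i 1≤i i≤n b∈X̂ X̂-single a∈R c∈L =
    inj₂ (inj₁ (∈X̂⇒∈ends i 1≤i i≤n b∈X̂ λ 1<i i<n →
      no-inner-apex i 1<i i<n X̂-single (∈⇒1≤card (Rₛ (2 * i ∸ 1)) a∈R) (∈⇒1≤card (Lₛ (2 * i + 1)) c∈L)))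
  ... | hat-pair i 1≤i 1+i≤n a∈X̂ c∈X̂ with i ≟ 1
  ...   | yes refl = inj₁ (from T-∨ (inj₁ a∈X̂))
  ...   | no  i≢1  = inj₂ (inj₂ (∈X̂⇒∈ends (suc i) z<s 1+i≤n c∈X̂ λ _ 2+i≤n →
      <⇒≱ (≤-trans (s≤s (s≤s (≤∧≢⇒< 1≤i (i≢1 ∘ sym)))) 2+i≤n) n≤3))

middle-index : ∀ {i n} → 1 < i → i < n → n ≤ 3 → i ≡ 2 × n ≡ 3
middle-index 1<i i<n n≤3 = ≤-antisym (s≤s⁻¹ (≤-trans i<n n≤3)) 1<i , ≤-antisym n≤3 (≤-trans (s≤s 1<i) i<n)

module _ {G : Graph} {idx : Fin (Graph.N G) → ℕ} {hat : VSet (Graph.N G)} {lmr : Fin (Graph.N G) → LMR} where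
  open Graph G using (N)

  module _ (C : PoT.Conditions G 4 idx hat lmr) where
    open PoT G 4 idx hat lmr
    open PoT.Conditions C
    open PathOfTriangles G 4 idx hat lmr C

    length-four-cells : List Cell
    length-four-cells =
      X̂-cell 1 ∷ X̂-cell 2 ∷ X̂-cell 3 ∷ X̂-cell 4 ∷ part-cell 3 M ∷ part-cell 5 M ∷ part-cell 7 M ∷
      part-cell 1 R ∷ part-cell 3 L ∷ part-cell 7 R ∷ part-cell 9 L ∷ []

    length-four-has-ten-vertices : 10 ≤ N
    length-four-has-ten-vertices with left-end | right-end
    ... | inj₂ (R₁ , L₃) | inj₂ (R₇ , L₉) = sum-bounds≤N length-four-cells
      (X̂-nonempty 1 ∷ X̂-nonempty 2 ∷ X̂-nonempty 3 ∷ X̂-nonempty 4 ∷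
       M-nonempty 1 ∷ M-nonempty 2 ∷ M-nonempty 3 ∷ R₁ ∷ L₃ ∷ R₇ ∷ z≤n ∷ [])
    ... | inj₂ (R₁ , L₃) | inj₁ X̂₃≥2 = sum-bounds≤N length-four-cells
      (X̂-nonempty 1 ∷ X̂-nonempty 2 ∷ X̂₃≥2 ∷ X̂-nonempty 4 ∷
       M-nonempty 1 ∷ M-nonempty 2 ∷ M-nonempty 3 ∷ R₁ ∷ L₃ ∷ z≤n ∷ z≤n ∷ [])
    ... | inj₁ X̂₂≥2 | inj₂ (R₇ , L₉) = sum-bounds≤N length-four-cells
      (X̂-nonempty 1 ∷ X̂₂≥2 ∷ X̂-nonempty 3 ∷ X̂-nonempty 4 ∷
       M-nonempty 1 ∷ M-nonempty 2 ∷ M-nonempty 3 ∷ z≤n ∷ z≤n ∷ R₇ ∷ L₉ ∷ [])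
    ... | inj₁ X̂₂≥2 | inj₁ X̂₃≥2 with P1-one 2 (s≤s z≤n) (s≤s (s≤s (s≤s z≤n)))
    ...   | inj₁ X̂₂-single = ⊥-elim (<⇒≢ X̂₂≥2 (sym X̂₂-single))
    ...   | inj₂ X̂₃-single = ⊥-elim (<⇒≢ X̂₃≥2 (sym X̂₃-single))

  module _ {m : ℕ} (C : PoT.Conditions G (5 + m) idx hat lmr) where
    open PoT G (5 + m) idx hat lmr
    open PathOfTriangles G (5 + m) idx hat lmr C

    length-five-cells : List Cell
    length-five-cells =
      X̂-cell 1 ∷ X̂-cell 2 ∷ X̂-cell 3 ∷ X̂-cell 4 ∷ X̂-cell 5 ∷
      part-cell 3 M ∷ part-cell 5 M ∷ part-cell 7 M ∷ part-cell 9 M ∷ part-cell 1 R ∷ []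

    length-five-or-more-has-ten-vertices : 10 ≤ N
    length-five-or-more-has-ten-vertices with left-end
    ... | inj₂ (R₁ , _) = sum-bounds≤N length-five-cells
      (X̂-nonempty 1 ∷ X̂-nonempty 2 ∷ X̂-nonempty 3 ∷ X̂-nonempty 4 ∷ X̂-nonempty 5 ∷
       M-nonempty 1 ∷ M-nonempty 2 ∷ M-nonempty 3 ∷ M-nonempty 4 ∷ R₁ ∷ [])
    ... | inj₁ X̂₂≥2 = sum-bounds≤N length-five-cells
      (X̂-nonempty 1 ∷ X̂₂≥2 ∷ X̂-nonempty 3 ∷ X̂-nonempty 4 ∷ X̂-nonempty 5 ∷
       M-nonempty 1 ∷ M-nonempty 2 ∷ M-nonempty 3 ∷ M-nonempty 4 ∷ z≤n ∷ [])

  module _ (C : PoT.Conditions G 3 idx hat lmr) where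
    open PoT G 3 idx hat lmr
    open PathOfTriangles G 3 idx hat lmr C

    middle-apex-cells : List Cell
    middle-apex-cells =
      X̂-cell 1 ∷ X̂-cell 2 ∷ X̂-cell 3 ∷ part-cell 3 M ∷ part-cell 3 R ∷ part-cell 5 L ∷
      part-cell 1 R ∷ part-cell 3 L ∷ part-cell 5 R ∷ part-cell 7 L ∷ []

    middle-apex-has-ten-vertices : card (Xh 2) ≡ 1 → 1 ≤ card (Rₛ 3) → 1 ≤ card (Lₛ 5) → 10 ≤ N
    middle-apex-has-ten-vertices X̂₂-single R₃ L₅ with left-end | right-end
    ... | inj₁ X̂₂≥2 | _         = ⊥-elim (<⇒≢ X̂₂≥2 (sym X̂₂-single))
    ... | _         | inj₁ X̂₂≥2 = ⊥-elim (<⇒≢ X̂₂≥2 (sym X̂₂-single))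
    ... | inj₂ (R₁ , L₃) | inj₂ (R₅ , L₇) = sum-bounds≤N middle-apex-cells
      (X̂-nonempty 1 ∷ X̂-nonempty 2 ∷ X̂-nonempty 3 ∷ M-nonempty 1 ∷ R₃ ∷ L₅ ∷ R₁ ∷ L₃ ∷ R₅ ∷ L₇ ∷ [])

  path-length≤3 : ∀ {n} → PoT.Conditions G n idx hat lmr → N ≤ 9 → n ≤ 3
  path-length≤3 {0} _ _ = z≤n
  path-length≤3 {1} _ _ = s≤s z≤n
  path-length≤3 {2} _ _ = s≤s (s≤s z≤n)
  path-length≤3 {3} _ _ = ≤-refl
  path-length≤3 {4} C N≤9 = ⊥-elim (<⇒≱ (length-four-has-ten-vertices C) N≤9)
  path-length≤3 {suc (suc (suc (suc (suc _))))} C N≤9 =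
    ⊥-elim (<⇒≱ (length-five-or-more-has-ten-vertices C) N≤9)

  no-inner-apex : ∀ {n} (C : PoT.Conditions G n idx hat lmr) → N ≤ 9 →
                  PathOfTriangles.NoInnerApex G n idx hat lmr C
  no-inner-apex C N≤9 i 1<i i<n with middle-index 1<i i<n (path-length≤3 C N≤9)
  ... | refl , refl = λ X̂₂-single R₃ L₅ → <⇒≱ (middle-apex-has-ten-vertices C X̂₂-single R₃ L₅) N≤9

lemma3p5 : (G : Graph) → IsPathOfTriangles G → Graph.N G ≤ 9 → Λ≤ G 2
lemma3p5 G (n , idx , hat , lmr , C) N≤9 =
  ends , card-ends≤2 ,
  meets-all-triangles-if-sorted G ends idx stable
    (sorted-triangle-meets-ends (path-length≤3 C N≤9) (no-inner-apex C N≤9))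
  where
  open PoT.Conditions C using (stable)
  open PathOfTriangles G n idx hat lmr C
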